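{- Let $(a_n)_{n\ge 1}$ be defined by $a_1=1$, $a_2=2$ and $a_{n+1}=n\,a_n+a_{n-1}$ for $n\ge 2$. If $x$ is an integer with $a_n\le x<a_{n+1}$, then the coefficient of $a_n$ in the legal decomposition of $x$ is $\lfloor x/a_n\rfloor$.
   Context: A legal decomposition of a positive integer $x$ is a representation $x=\sum_{i=1}^m s_i a_i$ with $s_i\in\{0,1,\ldots,i\}$ and such that if $s_i=i$ then $s_{i-1}=0$. Every positive integer has exactly one legal decomposition (two legal decompositions with the same sum are identical, where coefficients not written are zero); "the legal decomposition" refers to it. -}

module Defs where

open import Data.Nat using (ℕ; zero; suc; _+_; _*_; _≤_; NonZero)
open import Data.List using (List; []; _∷_; length)
open import Relation.Binary.PropositionalEquality using (_≡_)

-- The sequence a, 1-indexed: a 1 = 1, a 2 = 2, a (n+1) = n * a n + a (n-1) for n ≥ 2.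
-- (a 0 is an unused filler value 0; it never appears in the statement.)
a : ℕ → ℕ
a zero = 0
a (suc zero) = 1
a (suc (suc zero)) = 2
a (suc (suc (suc k))) = suc (suc k) * a (suc (suc k)) + a (suc k)

-- Coefficient of a_i in a coefficient list s = [s_1, ..., s_m] (1-indexed;
-- coefficients not written are zero; index 0 is unused and gives 0).
coeff : List ℕ → ℕ → ℕ
coeff []       _             = 0
coeff (_ ∷ _)  zero          = 0
coeff (c ∷ _)  (suc zero)    = c
coeff (_ ∷ cs) (suc (suc i)) = coeff cs (suc i)

value : List ℕ → ℕ
value s = go 1 s
  where
  go : ℕ → List ℕ → ℕ
  go i []       = 0
  go i (c ∷ cs) = c * a i + go (suc i) cs

record Legal (s : List ℕ) : Set where
  field
    bounded : ∀ i → 1 ≤ i → coeff s i ≤ i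
    maximal : ∀ i → 2 ≤ i → coeff s i ≡ i → coeff s (i Data.Nat.∸ 1) ≡ 0

LegalDecomp : ℕ → List ℕ → Set
LegalDecomp x s = Legal s Data.Product.× value s ≡ x
  where import Data.Product

a-suc-pos : ∀ k → 1 ≤ a (suc k)
a-suc-pos zero = Data.Nat.s≤s Data.Nat.z≤n
a-suc-pos (suc zero) = Data.Nat.s≤s Data.Nat.z≤n
a-suc-pos (suc (suc k)) =
  Data.Nat.Properties.≤-trans (a-suc-pos k)
    (Data.Nat.Properties.m≤n+m (a (suc k)) (suc (suc k) * a (suc (suc k))))
  where import Data.Nat.Properties

a-suc-nonzero : ∀ k → NonZero (a (suc k))
a-suc-nonzero k = Data.Nat.>-nonZero (a-suc-pos k)

-- Legality forces every partial sum to stay below the next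
-- term: Σ_{i ≤ m} s_i a_i < a_{m+1}, by induction in steps of two using
-- a_{m+1} = m a_m + a_{m-1} (if s_m < m the new term fits under m a_m, and if s_m = m then
-- s_{m-1} = 0 and the term a_{m-1} is freed).  Since a is increasing, x < a_{n+1} kills every
-- term beyond n, so x = s_n a_n + r with r = Σ_{i < n} s_i a_i < a_n, and s_n = ⌊x / a_n⌋.
module Submission where

open import Defs
open import Data.Nat using (ℕ; zero; suc; _+_; _*_; _≤_; _<_; _≤′_; ≤′-refl; ≤′-step; _/_; z≤n; s≤s; NonZero)
open import Data.Nat.Properties
open import Data.Nat.DivMod using (+-distrib-/-∣ʳ; m<n⇒m/n≡0; m*n/n≡m)
open import Data.Nat.Divisibility using (divides-refl)
open import Data.List using (List; []; _∷_; length)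
open import Data.Product using (_,_)
open import Data.Sum using (inj₁; inj₂)
open import Relation.Nullary using (contradiction)
open import Relation.Binary.PropositionalEquality

[r+q*d]/d≡q : ∀ {r} q {d} .{{_ : NonZero d}} → r < d → (r + q * d) / d ≡ q
[r+q*d]/d≡q {r} q {d} r<d = begin
  (r + q * d) / d    ≡⟨ +-distrib-/-∣ʳ r (divides-refl q) ⟩
  r / d + q * d / d  ≡⟨ cong₂ _+_ (m<n⇒m/n≡0 r<d) (m*n/n≡m q d) ⟩
  q                  ∎
  where open ≡-Reasoning

m*n<n⇒m≡0 : ∀ m {n} → m * n < n → m ≡ 0
m*n<n⇒m≡0 zero    _     = refl
m*n<n⇒m≡0 (suc m) {n} p = contradiction p (≤⇒≯ (m≤m+n n (m * n)))

a-suc≤a-suc-suc : ∀ m → a (suc m) ≤ a (suc (suc m))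
a-suc≤a-suc-suc zero    = s≤s z≤n
a-suc≤a-suc-suc (suc m) = ≤-trans (m≤m+n x (suc m * x)) (m≤m+n (x + suc m * x) (a (suc m)))
  where x = a (suc (suc m))

a-suc-mono : ∀ {m n} → m ≤′ n → a (suc m) ≤ a (suc n)
a-suc-mono ≤′-refl           = ≤-refl
a-suc-mono (≤′-step {n} m≤′n) = ≤-trans (a-suc-mono m≤′n) (a-suc≤a-suc-suc n)

partialSum : (ℕ → ℕ) → ℕ → ℕ
partialSum f zero    = 0
partialSum f (suc m) = partialSum f m + f (suc m) * a (suc m)

partialSum-pad : ∀ f m d → (∀ j → m < j → f j ≡ 0) → partialSum f (m + d) ≡ partialSum f m
partialSum-pad f m zero    _      = cong (partialSum f) (+-identityʳ m)
partialSum-pad f m (suc d) beyond = begin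
  partialSum f (m + suc d)                              ≡⟨ cong (partialSum f) (+-suc m d) ⟩
  partialSum f (m + d) + f (suc (m + d)) * a (suc (m + d))
    ≡⟨ cong (λ c → partialSum f (m + d) + c * a (suc (m + d))) (beyond _ (s≤s (m≤m+n m d))) ⟩
  partialSum f (m + d) + 0                              ≡⟨ +-identityʳ _ ⟩
  partialSum f (m + d)                                  ≡⟨ partialSum-pad f m d beyond ⟩
  partialSum f m                                        ∎
  where open ≡-Reasoning

partialSum-truncate : ∀ f n d → partialSum f (n + d) < a (suc n) → partialSum f (n + d) ≡ partialSum f n
partialSum-truncate f n zero    _   = cong (partialSum f) (+-identityʳ n)
partialSum-truncate f n (suc d) bound rewrite +-suc n d = begin-equality
  partialSum f (n + d) + f j * a j  ≡⟨ cong (λ c → partialSum f (n + d) + c * a j) fj≡0 ⟩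
  partialSum f (n + d) + 0          ≡⟨ +-identityʳ _ ⟩
  partialSum f (n + d)              ≡⟨ partialSum-truncate f n d (≤-<-trans (m≤m+n _ _) bound) ⟩
  partialSum f n                    ∎
  where
  open ≤-Reasoning
  j = suc (n + d)
  fj≡0 : f j ≡ 0
  fj≡0 = m*n<n⇒m≡0 (f j) (begin-strict
    f j * a j                          ≤⟨ m≤n+m _ _ ⟩
    partialSum f (n + d) + f j * a j   <⟨ bound ⟩
    a (suc n)                          ≤⟨ a-suc-mono (≤⇒≤′ (m≤m+n n d)) ⟩
    a j                                ∎)

module _ {s : List ℕ} (legal : Legal s) where
  open Legal legal
  private
    f = coeff s

  partialSum-legal<-step : ∀ j → partialSum f (suc j) < a (suc (suc j)) → partialSum f j < a (suc j) →
                           partialSum f (suc (suc j)) < a (suc (suc (suc j)))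
  partialSum-legal<-step j S₁< S₀< with m≤n⇒m<n∨m≡n (bounded (suc (suc j)) (s≤s z≤n))
  ... | inj₁ fm<m = begin-strict
    partialSum f (suc j) + f m * a m  <⟨ +-monoˡ-< (f m * a m) S₁< ⟩
    a m + f m * a m                   ≤⟨ *-monoˡ-≤ (a m) fm<m ⟩
    m * a m                           ≤⟨ m≤m+n (m * a m) (a (suc j)) ⟩
    a (suc m)                         ∎
    where
    open ≤-Reasoning
    m = suc (suc j)
  ... | inj₂ fm≡m = begin-strict
    partialSum f (suc j) + f m * a m  ≡⟨ cong₂ (λ p c → p + c * a m) previous-sum fm≡m ⟩
    partialSum f j + m * a m          <⟨ +-monoˡ-< (m * a m) S₀< ⟩
    a (suc j) + m * a m               ≡⟨ +-comm (a (suc j)) (m * a m) ⟩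
    a (suc m)                         ∎
    where
    open ≤-Reasoning
    m = suc (suc j)
    previous-sum : partialSum f (suc j) ≡ partialSum f j
    previous-sum = begin-equality
      partialSum f j + f (suc j) * a (suc j)
        ≡⟨ cong (λ c → partialSum f j + c * a (suc j)) (maximal m (s≤s (s≤s z≤n)) fm≡m) ⟩
      partialSum f j + 0                      ≡⟨ +-identityʳ _ ⟩
      partialSum f j                          ∎

  partialSum-legal< : ∀ m → partialSum f m < a (suc m)
  partialSum-legal< zero          = s≤s z≤n
  partialSum-legal< (suc zero)    = s≤s (subst (_≤ 1) (sym (*-identityʳ _)) (bounded 1 (s≤s z≤n)))
  partialSum-legal< (suc (suc j)) =
    partialSum-legal<-step j (partialSum-legal< (suc j)) (partialSum-legal< j)

-- `value` is defined through a local helper that cannot be named from here.  Abstracting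
-- `c ∷ cs` and `2` turns the unfolded goal into a pattern, so unification recovers the helper
-- as `valueFrom` (its first argument is the unused parameter of the where-block).
mutual
  valueFrom : List ℕ → ℕ → List ℕ → ℕ
  valueFrom = _

  value-∷ : ∀ c cs → value (c ∷ cs) ≡ c * 1 + valueFrom (c ∷ cs) 2 cs
  value-∷ c cs with c ∷ cs | 2
  ... | _ | _ = refl

valueFrom-partialSum : ∀ f w i cs → (∀ j → coeff cs (suc j) ≡ f (i + suc j)) →
                       partialSum f i + valueFrom w (suc i) cs ≡ partialSum f (i + length cs)
valueFrom-partialSum f w i []       _     =
  trans (+-identityʳ _) (cong (partialSum f) (sym (+-identityʳ i)))
valueFrom-partialSum f w i (c ∷ cs) shift = begin
  partialSum f i + (c * a (suc i) + valueFrom w (suc (suc i)) cs)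
    ≡⟨ sym (+-assoc (partialSum f i) _ _) ⟩
  partialSum f i + c * a (suc i) + valueFrom w (suc (suc i)) cs
    ≡⟨ cong (λ c′ → partialSum f i + c′ * a (suc i) + valueFrom w (suc (suc i)) cs)
            (trans (shift 0) (cong f (+-comm i 1))) ⟩
  partialSum f (suc i) + valueFrom w (suc (suc i)) cs
    ≡⟨ valueFrom-partialSum f w (suc i) cs (λ j → trans (shift (suc j)) (cong f (+-suc i (suc j)))) ⟩
  partialSum f (suc i + length cs)
    ≡⟨ cong (partialSum f) (sym (+-suc i (length cs))) ⟩
  partialSum f (i + suc (length cs))
    ∎
  where open ≡-Reasoning

value-partialSum : ∀ s → value s ≡ partialSum (coeff s) (length s)
value-partialSum []       = refl
value-partialSum (c ∷ cs) =
  trans (value-∷ c cs) (valueFrom-partialSum (coeff (c ∷ cs)) (c ∷ cs) 1 cs (λ _ → refl))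

coeff-beyond : ∀ s j → length s < j → coeff s j ≡ 0
coeff-beyond []       _             _           = refl
coeff-beyond (_ ∷ _)  (suc zero)    (s≤s ())
coeff-beyond (_ ∷ cs) (suc (suc j)) (s≤s len<j) = coeff-beyond cs (suc j) len<j

theorem1p3 : (k x : ℕ) → (s : List ℕ) → a (suc k) ≤ x → x < a (suc (suc k)) →
    LegalDecomp x s → coeff s (suc k) ≡ _/_ x (a (suc k)) {{a-suc-nonzero k}}
theorem1p3 k x s _ x<a (legal , value≡x) = begin
  f n                                   ≡⟨ sym ([r+q*d]/d≡q (f n) (partialSum-legal< legal k)) ⟩
  (partialSum f k + f n * a n) / a n    ≡⟨ cong (_/ a n) (sym x≡partialSum) ⟩
  x / a n                               ∎
  where
  open ≡-Reasoning
  n = suc k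
  f = coeff s
  instance
    a-n-nonzero : NonZero (a n)
    a-n-nonzero = a-suc-nonzero k
  x≡partialSum-padded : x ≡ partialSum f (n + length s)
  x≡partialSum-padded = begin
    x                             ≡⟨ sym value≡x ⟩
    value s                       ≡⟨ value-partialSum s ⟩
    partialSum f (length s)       ≡⟨ sym (partialSum-pad f (length s) n (coeff-beyond s)) ⟩
    partialSum f (length s + n)   ≡⟨ cong (partialSum f) (+-comm (length s) n) ⟩
    partialSum f (n + length s)   ∎
  x≡partialSum : x ≡ partialSum f n
  x≡partialSum = trans x≡partialSum-padded
    (partialSum-truncate f n (length s) (subst (_< a (suc n)) x≡partialSum-padded x<a))
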